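{- (i) Let $2 \le k \le n-1$. Then $g(n,k) \ge g(n-1,k)$. (ii) Let $3 \le k \le n$. Then $g(n,k) \ge \frac{1}{k}\, g(n,k-1)$.
   Context: $S_n$ is the set of permutations of $[n]=\{1,\dots,n\}$, each regarded as the sequence of its values, and $S_{n,k}$ is the set of sequences of $k$ distinct elements of $[n]$. A sequence $x \in S_n$ covers $y \in S_{n,k}$ if $y$ is a (not necessarily contiguous) subsequence of $x$. A ${\rm PSCA}(n,k,\lambda)$ is a multiset $P$ of elements of $S_n$ such that every $y \in S_{n,k}$ is covered by exactly $\lambda$ elements of $P$, counted with multiplicity. For $2 \le k \le n$, $g(n,k)$ is the smallest positive integer $\lambda$ for which a ${\rm PSCA}(n,k,\lambda)$ exists. -}

module Defs where

open import Data.Nat using (ℕ; _≤_; _<_)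
open import Data.Fin using (Fin)
open import Data.Fin.Properties using (_≟_)
open import Data.List using (List; length; filter; allFin)
open import Data.List.Relation.Unary.All using (All)
open import Data.List.Relation.Unary.Unique.Propositional using (Unique)
open import Data.List.Relation.Binary.Permutation.Propositional using (_↭_)
open import Data.Product using (Σ; _×_)
open import Relation.Binary.PropositionalEquality using (_≡_)

-- S_n : a permutation of [n], as the sequence of its values
-- (a list that is a rearrangement of [0, …, n-1]).
IsPerm : (n : ℕ) → List (Fin n) → Set
IsPerm n x = x ↭ allFin n

IsKSeq : (n k : ℕ) → List (Fin n) → Set
IsKSeq n k y = Unique y × length y ≡ k

module _ {n : ℕ} where
  open import Data.List.Relation.Binary.Sublist.DecPropositional (_≟_ {n = n}) as Sub
    using (_⊆_; _⊆?_)

  Covers : List (Fin n) → List (Fin n) → Set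
  Covers x y = y ⊆ x

  -- number of members of the multiset P (a list) covering y, with multiplicity
  coverCount : List (List (Fin n)) → List (Fin n) → ℕ
  coverCount P y = length (filter (λ x → y ⊆? x) P)

IsPSCA : (n k λ′ : ℕ) → List (List (Fin n)) → Set
IsPSCA n k λ′ P =
  All (IsPerm n) P × ((y : List (Fin n)) → IsKSeq n k y → coverCount P y ≡ λ′)

PSCAExists : (n k λ′ : ℕ) → Set
PSCAExists n k λ′ = Σ (List (List (Fin n))) (IsPSCA n k λ′)

IsG : (n k g : ℕ) → Set
IsG n k g = (0 < g × PSCAExists n k g) × ((λ′ : ℕ) → 0 < λ′ → PSCAExists n k λ′ → g ≤ λ′)

module Submission where

-- (i) Deleting the symbol 0 from every permutation of a PSCA(n, k, λ) and relabelling
-- turns it into a PSCA(n - 1, k, λ): a k-sequence y over [n - 1] is covered by the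
-- shortened permutation exactly when its shift map suc y is covered by the original.
-- (ii) Given a PSCA(n, k, λ) and a (k - 1)-sequence y, pick a symbol z outside y. The k
-- ways of inserting z into y give k distinct k-sequences, and a permutation x covers
-- exactly one of them if it covers y and none otherwise (the occurrence of z in x fixes
-- where z must go). Summing over the insertions, y is covered k λ times.

open import Defs
open import Algebra.Properties.CommutativeSemigroup using (interchange)
open import Data.Empty using (⊥-elim)
open import Data.Fin using (Fin; zero; suc)
open import Data.Fin.Properties using (_≟_; suc-injective; pigeonhole; ¬∀⟶∃¬)
  renaming (<-irrefl to <-irreflᶠ)
open import Data.List using (List; []; _∷_; [_]; length; allFin; map; lookup)
open import Data.List.Membership.Propositional using (_∈_; _∉_)
open import Data.List.Membership.Propositional.Properties using (∈-allFin)
open import Data.List.Properties using (length-map; map-tabulate; map-cong; map-∘)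
open import Data.List.Relation.Binary.Permutation.Propositional
  using (_↭_; refl; prep; swap; trans; ↭-sym; ↭⇒↭ₛ)
open import Data.List.Relation.Binary.Permutation.Propositional.Properties using (∈-resp-↭)
open import Data.List.Relation.Binary.Sublist.Propositional
  using (_⊆_; []; _∷ʳ_; _∷_; minimum; from∈) renaming (lookup to ⊆-lookup)
open import Data.List.Relation.Unary.All as All using (All; []; _∷_)
open import Data.List.Relation.Unary.All.Properties using (All¬⇒¬Any; ¬Any⇒All¬; map⁺)
open import Data.List.Relation.Unary.Any as Any using (here; there; any?)
open import Data.List.Relation.Unary.Any.Properties using (lookup-index)
open import Data.List.Relation.Unary.Unique.Propositional using (Unique; []; _∷_)
open import Data.List.Relation.Unary.Unique.Propositional.Properties using (allFin⁺)
  renaming (map⁺ to Unique-map⁺)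
open import Data.Nat using (ℕ; suc; _≤_; _<_; _*_; _∸_; _+_; z≤n; s≤s)
open import Data.Nat.ListAction using (sum)
open import Data.Nat.Properties using (+-commutativeSemigroup; +-identityʳ; *-zeroʳ)
open import Data.Product using (∃; _×_; _,_)
open import Function using (_∘_)
open import Relation.Binary.PropositionalEquality
  using (_≡_; _≢_; refl; sym; cong; cong₂; subst; setoid; module ≡-Reasoning)
  renaming (trans to ≡-trans)
open import Relation.Nullary using (¬_; Dec; yes; no)

sum-map-const : ∀ {A : Set} (f : A → ℕ) {g : ℕ} (L : List A) →
                All (λ w → f w ≡ g) L → sum (map f L) ≡ length L * g
sum-map-const f [] [] = refl
sum-map-const f (w ∷ L) (e ∷ es) = cong₂ _+_ e (sum-map-const f L es)

sum-map-zero : ∀ {A : Set} (f : A → ℕ) (L : List A) → All (λ w → f w ≡ 0) L → sum (map f L) ≡ 0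
sum-map-zero f L es = ≡-trans (sum-map-const f L es) (*-zeroʳ (length L))

deleteZero : ∀ {m} → List (Fin (suc m)) → List (Fin m)
deleteZero []          = []
deleteZero (zero  ∷ x) = deleteZero x
deleteZero (suc i ∷ x) = i ∷ deleteZero x

deleteZero-map-suc : ∀ {m} (y : List (Fin m)) → deleteZero (map suc y) ≡ y
deleteZero-map-suc []      = refl
deleteZero-map-suc (b ∷ y) = cong (b ∷_) (deleteZero-map-suc y)

deleteZero-allFin : ∀ m → deleteZero (allFin (suc m)) ≡ allFin m
deleteZero-allFin m = ≡-trans (cong (deleteZero ∘ (zero ∷_)) (sym (map-tabulate (λ i → i) suc)))
                              (deleteZero-map-suc (allFin m))

deleteZero-↭ : ∀ {m} {x x′ : List (Fin (suc m))} → x ↭ x′ → deleteZero x ↭ deleteZero x′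
deleteZero-↭ refl                     = refl
deleteZero-↭ (prep zero p)            = deleteZero-↭ p
deleteZero-↭ (prep (suc i) p)         = prep i (deleteZero-↭ p)
deleteZero-↭ (swap zero zero p)       = deleteZero-↭ p
deleteZero-↭ (swap zero (suc j) p)    = prep j (deleteZero-↭ p)
deleteZero-↭ (swap (suc i) zero p)    = prep i (deleteZero-↭ p)
deleteZero-↭ (swap (suc i) (suc j) p) = swap i j (deleteZero-↭ p)
deleteZero-↭ (trans p q)              = trans (deleteZero-↭ p) (deleteZero-↭ q)

IsPerm-deleteZero : ∀ {m} {x : List (Fin (suc m))} → IsPerm (suc m) x → IsPerm m (deleteZero x)
IsPerm-deleteZero {m} {x} p = subst (deleteZero x ↭_) (deleteZero-allFin m) (deleteZero-↭ p)

map-suc-⊆⇒⊆-deleteZero : ∀ {m} (y : List (Fin m)) (x : List (Fin (suc m))) →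
                         map suc y ⊆ x → y ⊆ deleteZero x
map-suc-⊆⇒⊆-deleteZero []      []          []        = []
map-suc-⊆⇒⊆-deleteZero y       (zero  ∷ x) (_ ∷ʳ p)  = map-suc-⊆⇒⊆-deleteZero y x p
map-suc-⊆⇒⊆-deleteZero y       (suc i ∷ x) (_ ∷ʳ p)  = i ∷ʳ map-suc-⊆⇒⊆-deleteZero y x p
map-suc-⊆⇒⊆-deleteZero (b ∷ y) (suc i ∷ x) (eq ∷ p) = suc-injective eq ∷ map-suc-⊆⇒⊆-deleteZero y x p

⊆-deleteZero⇒map-suc-⊆ : ∀ {m} (y : List (Fin m)) (x : List (Fin (suc m))) →
                         y ⊆ deleteZero x → map suc y ⊆ x
⊆-deleteZero⇒map-suc-⊆ []      []          []        = []
⊆-deleteZero⇒map-suc-⊆ y       (zero  ∷ x) p         = zero ∷ʳ ⊆-deleteZero⇒map-suc-⊆ y x p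
⊆-deleteZero⇒map-suc-⊆ y       (suc i ∷ x) (_ ∷ʳ p)  = suc i ∷ʳ ⊆-deleteZero⇒map-suc-⊆ y x p
⊆-deleteZero⇒map-suc-⊆ (b ∷ y) (suc i ∷ x) (eq ∷ p) = cong suc eq ∷ ⊆-deleteZero⇒map-suc-⊆ y x p

module _ {m : ℕ} where
  open import Data.List.Relation.Binary.Sublist.DecPropositional (_≟_ {n = m})
    using () renaming (_⊆?_ to _⊆?ₘ_)
  open import Data.List.Relation.Binary.Sublist.DecPropositional (_≟_ {n = suc m})
    using () renaming (_⊆?_ to _⊆?ₛ_)

  coverCount-map-deleteZero : (P : List (List (Fin (suc m)))) (y : List (Fin m)) →
                              coverCount (map deleteZero P) y ≡ coverCount P (map suc y)
  coverCount-map-deleteZero []      y = refl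
  coverCount-map-deleteZero (x ∷ P) y with y ⊆?ₘ deleteZero x | map suc y ⊆?ₛ x
  ... | yes _ | yes _ = cong suc (coverCount-map-deleteZero P y)
  ... | no _  | no _  = coverCount-map-deleteZero P y
  ... | yes p | no q  = ⊥-elim (q (⊆-deleteZero⇒map-suc-⊆ y x p))
  ... | no p  | yes q = ⊥-elim (p (map-suc-⊆⇒⊆-deleteZero y x q))

IsPSCA-deleteZero : ∀ {m k λ′} {P : List (List (Fin (suc m)))} →
                    IsPSCA (suc m) k λ′ P → IsPSCA m k λ′ (map deleteZero P)
IsPSCA-deleteZero {P = P} (perms , cov) =
  map⁺ (All.map IsPerm-deleteZero perms) ,
  λ y (uy , ly) → ≡-trans (coverCount-map-deleteZero P y)
                          (cov (map suc y) (Unique-map⁺ suc-injective uy , ≡-trans (length-map suc y) ly))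

module _ {n : ℕ} where
  open import Data.List.Relation.Binary.Sublist.DecPropositional (_≟_ {n = n}) using (_⊆?_)

  Seq : Set
  Seq = List (Fin n)

  coverIndicator : Seq → Seq → ℕ
  coverIndicator x y = coverCount [ x ] y

  coverCount-∷ : (x : Seq) (P : List Seq) (y : Seq) →
                 coverCount (x ∷ P) y ≡ coverIndicator x y + coverCount P y
  coverCount-∷ x P y with y ⊆? x
  ... | yes _ = refl
  ... | no _  = refl

  coverIndicator-⊆ : {x y : Seq} → y ⊆ x → coverIndicator x y ≡ 1
  coverIndicator-⊆ {x} {y} y⊆x with y ⊆? x
  ... | yes _   = refl
  ... | no y⊈x  = ⊥-elim (y⊈x y⊆x)

  coverIndicator-⊈ : {x y : Seq} → ¬ y ⊆ x → coverIndicator x y ≡ 0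
  coverIndicator-⊈ {x} {y} y⊈x with y ⊆? x
  ... | yes y⊆x = ⊥-elim (y⊈x y⊆x)
  ... | no _    = refl

  coverIndicator-resp-⇔ : {x x′ y y′ : Seq} → (y ⊆ x → y′ ⊆ x′) → (y′ ⊆ x′ → y ⊆ x) →
                          coverIndicator x y ≡ coverIndicator x′ y′
  coverIndicator-resp-⇔ {x} {x′} {y} {y′} to from with y′ ⊆? x′
  ... | yes y′⊆x′ = coverIndicator-⊆ (from y′⊆x′)
  ... | no y′⊈x′  = coverIndicator-⊈ (y′⊈x′ ∘ to)

  coverIndicator-∷-≢ : {a b : Fin n} (x w : Seq) → b ≢ a →
                       coverIndicator (a ∷ x) (b ∷ w) ≡ coverIndicator x (b ∷ w)
  coverIndicator-∷-≢ {a} {b} x w b≢a = coverIndicator-resp-⇔ drop (a ∷ʳ_)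
    where
    drop : b ∷ w ⊆ a ∷ x → b ∷ w ⊆ x
    drop (_ ∷ʳ p) = p
    drop (b≡a ∷ _) = ⊥-elim (b≢a b≡a)

  coverIndicator-∷-∉ : {a : Fin n} (x w : Seq) → a ∉ x →
                       coverIndicator (a ∷ x) (a ∷ w) ≡ coverIndicator x w
  coverIndicator-∷-∉ x w a∉x = coverIndicator-resp-⇔ drop (refl ∷_)
    where
    drop : _ ∷ w ⊆ _ ∷ x → w ⊆ x
    drop (_ ∷ʳ p) = ⊥-elim (a∉x (⊆-lookup p (here refl)))
    drop (_ ∷ p)  = p

  coverIndicator-∈-∉ : {z : Fin n} {x w : Seq} → z ∈ w → z ∉ x → coverIndicator x w ≡ 0
  coverIndicator-∈-∉ z∈w z∉x = coverIndicator-⊈ (λ w⊆x → z∉x (⊆-lookup w⊆x z∈w))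

  inserts : Fin n → Seq → List Seq
  inserts z []      = [ [ z ] ]
  inserts z (b ∷ y) = (z ∷ b ∷ y) ∷ map (b ∷_) (inserts z y)

  length-inserts : (z : Fin n) (y : Seq) → length (inserts z y) ≡ suc (length y)
  length-inserts z []      = refl
  length-inserts z (b ∷ y) = cong suc (≡-trans (length-map (b ∷_) (inserts z y)) (length-inserts z y))

  All-length-inserts : (z : Fin n) (y : Seq) → All (λ w → length w ≡ suc (length y)) (inserts z y)
  All-length-inserts z []      = refl ∷ []
  All-length-inserts z (b ∷ y) = refl ∷ map⁺ (All.map (cong suc) (All-length-inserts z y))

  inserts-∋ : (z : Fin n) (y : Seq) → All (z ∈_) (inserts z y)
  inserts-∋ z []      = here refl ∷ []
  inserts-∋ z (b ∷ y) = here refl ∷ map⁺ (All.map there (inserts-∋ z y))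

  All-inserts : {Q : Fin n → Set} (z : Fin n) (y : Seq) → Q z → All Q y → All (All Q) (inserts z y)
  All-inserts z []      qz []        = (qz ∷ []) ∷ []
  All-inserts z (b ∷ y) qz (qb ∷ qy) = (qz ∷ qb ∷ qy) ∷ map⁺ (All.map (qb ∷_) (All-inserts z y qz qy))

  Unique-inserts : {z : Fin n} {y : Seq} → Unique y → z ∉ y → All Unique (inserts z y)
  Unique-inserts {y = []}    []          z∉y = ([] ∷ []) ∷ []
  Unique-inserts {z} {b ∷ y} (b∉y ∷ uy) z∉y =
    (¬Any⇒All¬ (b ∷ y) z∉y ∷ b∉y ∷ uy) ∷
    map⁺ (All.zipWith (λ (b∉w , uw) → b∉w ∷ uw)
                      (All-inserts z y (z∉y ∘ here ∘ sym) b∉y , Unique-inserts uy (z∉y ∘ there)))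

  sum-coverIndicator-inserts-∷ : (x : Seq) (z b : Fin n) (y : Seq) →
    sum (map (coverIndicator x) (inserts z (b ∷ y))) ≡
    coverIndicator x (z ∷ b ∷ y) + sum (map (coverIndicator x ∘ (b ∷_)) (inserts z y))
  sum-coverIndicator-inserts-∷ x z b y =
    cong ((coverIndicator x (z ∷ b ∷ y) +_) ∘ sum) (sym (map-∘ (inserts z y)))

  sum-coverIndicator-inserts : {z : Fin n} {x y : Seq} → Unique x → z ∈ x → z ∉ y →
    sum (map (coverIndicator x) (inserts z y)) ≡ coverIndicator x y

  sum-coverIndicator-inserts-later : {z a b : Fin n} {x y : Seq} → All (a ≢_) x → Unique x → z ∈ x →
    z ∉ b ∷ y → Dec (b ≡ a) →
    sum (map (coverIndicator (a ∷ x)) (inserts z (b ∷ y))) ≡ coverIndicator (a ∷ x) (b ∷ y)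

  sum-coverIndicator-inserts {z} {x} {[]} _ z∈x _ = begin
    coverIndicator x [ z ] + 0 ≡⟨ +-identityʳ _ ⟩
    coverIndicator x [ z ]     ≡⟨ coverIndicator-⊆ (from∈ z∈x) ⟩
    1                          ≡⟨ sym (coverIndicator-⊆ (minimum x)) ⟩
    coverIndicator x []        ∎
    where open ≡-Reasoning
  sum-coverIndicator-inserts {z} {z ∷ x} {b ∷ y} (z∉x ∷ _) (here refl) z∉by = begin
    sum (map (coverIndicator (z ∷ x)) (inserts z (b ∷ y)))
      ≡⟨ sum-coverIndicator-inserts-∷ (z ∷ x) z b y ⟩
    coverIndicator (z ∷ x) (z ∷ b ∷ y) + sum (map (coverIndicator (z ∷ x) ∘ (b ∷_)) (inserts z y))
      ≡⟨ cong₂ _+_ (coverIndicator-∷-∉ x (b ∷ y) (All¬⇒¬Any z∉x))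
                   (sum-map-zero _ _ (All.map later-zero (inserts-∋ z y))) ⟩
    coverIndicator x (b ∷ y) + 0
      ≡⟨ +-identityʳ _ ⟩
    coverIndicator x (b ∷ y)
      ≡⟨ sym (coverIndicator-∷-≢ x y b≢z) ⟩
    coverIndicator (z ∷ x) (b ∷ y) ∎
    where
    open ≡-Reasoning
    b≢z : b ≢ z
    b≢z = z∉by ∘ here ∘ sym
    later-zero : ∀ {w} → z ∈ w → coverIndicator (z ∷ x) (b ∷ w) ≡ 0
    later-zero z∈w = ≡-trans (coverIndicator-∷-≢ x _ b≢z) (coverIndicator-∈-∉ (there z∈w) (All¬⇒¬Any z∉x))
  sum-coverIndicator-inserts {x = a ∷ x} {b ∷ y} (a∉x ∷ ux) (there z∈x) z∉by =
    sum-coverIndicator-inserts-later a∉x ux z∈x z∉by (b ≟ a)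

  sum-coverIndicator-inserts-later {z} {a} {b} {x} {y} a∉x ux z∈x z∉by (no b≢a) = begin
    sum (map (coverIndicator (a ∷ x)) (inserts z (b ∷ y)))
      ≡⟨ sum-coverIndicator-inserts-∷ (a ∷ x) z b y ⟩
    coverIndicator (a ∷ x) (z ∷ b ∷ y) + sum (map (coverIndicator (a ∷ x) ∘ (b ∷_)) (inserts z y))
      ≡⟨ cong₂ _+_ (coverIndicator-∷-≢ x (b ∷ y) z≢a)
                   (cong sum (map-cong (λ w → coverIndicator-∷-≢ x w b≢a) (inserts z y))) ⟩
    coverIndicator x (z ∷ b ∷ y) + sum (map (coverIndicator x ∘ (b ∷_)) (inserts z y))
      ≡⟨ sym (sum-coverIndicator-inserts-∷ x z b y) ⟩
    sum (map (coverIndicator x) (inserts z (b ∷ y)))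
      ≡⟨ sum-coverIndicator-inserts ux z∈x z∉by ⟩
    coverIndicator x (b ∷ y)
      ≡⟨ sym (coverIndicator-∷-≢ x y b≢a) ⟩
    coverIndicator (a ∷ x) (b ∷ y) ∎
    where
    open ≡-Reasoning
    z≢a : z ≢ a
    z≢a z≡a = All.lookup a∉x z∈x (sym z≡a)
  sum-coverIndicator-inserts-later {z} {a} {.a} {x} {y} a∉x ux z∈x z∉by (yes refl) = begin
    sum (map (coverIndicator (a ∷ x)) (inserts z (a ∷ y)))
      ≡⟨ sum-coverIndicator-inserts-∷ (a ∷ x) z a y ⟩
    coverIndicator (a ∷ x) (z ∷ a ∷ y) + sum (map (coverIndicator (a ∷ x) ∘ (a ∷_)) (inserts z y))
      ≡⟨ cong₂ _+_ (≡-trans (coverIndicator-∷-≢ x (a ∷ y) z≢a)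
                            (coverIndicator-∈-∉ (there (here refl)) a∉x′))
                   (cong sum (map-cong (λ w → coverIndicator-∷-∉ x w a∉x′) (inserts z y))) ⟩
    sum (map (coverIndicator x) (inserts z y))
      ≡⟨ sum-coverIndicator-inserts ux z∈x (z∉by ∘ there) ⟩
    coverIndicator x y
      ≡⟨ sym (coverIndicator-∷-∉ x y a∉x′) ⟩
    coverIndicator (a ∷ x) (a ∷ y) ∎
    where
    open ≡-Reasoning
    a∉x′ : a ∉ x
    a∉x′ = All¬⇒¬Any a∉x
    z≢a : z ≢ a
    z≢a z≡a = All.lookup a∉x z∈x (sym z≡a)

  sum-coverCount-∷ : (x : Seq) (P L : List Seq) →
    sum (map (coverCount (x ∷ P)) L) ≡ sum (map (coverIndicator x) L) + sum (map (coverCount P) L)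
  sum-coverCount-∷ x P []      = refl
  sum-coverCount-∷ x P (w ∷ L) =
    ≡-trans (cong₂ _+_ (coverCount-∷ x P w) (sum-coverCount-∷ x P L))
            (interchange +-commutativeSemigroup (coverIndicator x w) _ _ _)

  sum-coverCount-inserts : {z : Fin n} {y : Seq} (P : List Seq) → All (λ x → Unique x × z ∈ x) P →
    z ∉ y → sum (map (coverCount P) (inserts z y)) ≡ coverCount P y
  sum-coverCount-inserts {z} {y} [] [] _ = sum-map-zero (coverCount []) (inserts z y) (All.universal (λ _ → refl) _)
  sum-coverCount-inserts {z} {y} (x ∷ P) ((ux , z∈x) ∷ hP) z∉y = begin
    sum (map (coverCount (x ∷ P)) (inserts z y))
      ≡⟨ sum-coverCount-∷ x P (inserts z y) ⟩
    sum (map (coverIndicator x) (inserts z y)) + sum (map (coverCount P) (inserts z y))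
      ≡⟨ cong₂ _+_ (sum-coverIndicator-inserts ux z∈x z∉y) (sum-coverCount-inserts P hP z∉y) ⟩
    coverIndicator x y + coverCount P y
      ≡⟨ sym (coverCount-∷ x P y) ⟩
    coverCount (x ∷ P) y ∎
    where open ≡-Reasoning

  ∃∉-length< : (y : Seq) → length y < n → ∃ λ z → z ∉ y
  ∃∉-length< y |y|<n = ¬∀⟶∃¬ n (_∈ y) (λ z → any? (z ≟_) y) not-all
    where
    not-all : ¬ (∀ z → z ∈ y)
    not-all all∈ with pigeonhole |y|<n (Any.index ∘ all∈)
    ... | i , j , i<j , same-index =
      <-irreflᶠ (≡-trans (lookup-index (all∈ i))
                         (≡-trans (cong (lookup y) same-index) (sym (lookup-index (all∈ j))))) i<j

  IsPerm⇒Unique : {x : Seq} → IsPerm n x → Unique x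
  IsPerm⇒Unique p = Unique-resp-↭ (↭⇒↭ₛ (↭-sym p)) (allFin⁺ n)
    where open import Data.List.Relation.Binary.Permutation.Setoid.Properties (setoid (Fin n))
            using (Unique-resp-↭)

IsPSCA-lowerStrength : ∀ {n k λ′} {P : List (List (Fin n))} → k < n →
                       IsPSCA n (suc k) λ′ P → IsPSCA n k (suc k * λ′) P
IsPSCA-lowerStrength {n} {k} {λ′} {P} k<n (perms , cov) = perms , cover
  where
  cover : (y : List (Fin n)) → IsKSeq n k y → coverCount P y ≡ suc k * λ′
  cover y (uy , |y|≡k) with ∃∉-length< y (subst (λ l → suc l ≤ n) (sym |y|≡k) k<n)
  ... | z , z∉y = begin
    coverCount P y
      ≡⟨ sym (sum-coverCount-inserts P unique-∋z z∉y) ⟩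
    sum (map (coverCount P) (inserts z y))
      ≡⟨ sum-map-const (coverCount P) (inserts z y)
           (All.zipWith (λ (uw , |w|≡) → cov _ (uw , ≡-trans |w|≡ (cong suc |y|≡k)))
                        (Unique-inserts uy z∉y , All-length-inserts z y)) ⟩
    length (inserts z y) * λ′
      ≡⟨ cong (_* λ′) (≡-trans (length-inserts z y) (cong suc |y|≡k)) ⟩
    suc k * λ′ ∎
    where
    open ≡-Reasoning
    unique-∋z : All (λ x → Unique x × z ∈ x) P
    unique-∋z = All.map (λ p → IsPerm⇒Unique p , ∈-resp-↭ (↭-sym p) (∈-allFin z)) perms

lemma2p3 : ((n k g₁ g₂ : ℕ) → 2 ≤ k → k ≤ n ∸ 1 → IsG n k g₁ → IsG (n ∸ 1) k g₂ → g₂ ≤ g₁)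
    × ((n k g₁ g₂ : ℕ) → 3 ≤ k → k ≤ n → IsG n k g₁ → IsG n (k ∸ 1) g₂ → g₂ ≤ k * g₁)
lemma2p3 = part₁ , part₂
  where
  part₁ : (n k g₁ g₂ : ℕ) → 2 ≤ k → k ≤ n ∸ 1 → IsG n k g₁ → IsG (n ∸ 1) k g₂ → g₂ ≤ g₁
  part₁ 0       (suc (suc _)) _ _ _ ()
  part₁ (suc m) _ _ _ _ _ ((0<g₁ , P , psca) , _) (_ , minimal₂) =
    minimal₂ _ 0<g₁ (map deleteZero P , IsPSCA-deleteZero psca)

  part₂ : (n k g₁ g₂ : ℕ) → 3 ≤ k → k ≤ n → IsG n k g₁ → IsG n (k ∸ 1) g₂ → g₂ ≤ k * g₁
  part₂ n (suc k) (suc g₁) _ _ k≤n ((_ , P , psca) , _) (_ , minimal₂) =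
    minimal₂ _ (s≤s z≤n) (P , IsPSCA-lowerStrength k≤n psca)
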